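{- Let $G$ be a hole-with-hat-free graph. Let $C,D$ be disjoint anticonnected subsets of $V(G)$, complete to each other. Then no vertex of $V(G)\setminus(C\cup D)$ is both mixed on $C$ and mixed on $D$.
   Context: Graphs are finite and simple. A hole is an induced cycle of length at least four; a hole-with-hat is the subgraph induced by a hole $C$ together with a vertex $v\notin V(C)$ having exactly two neighbours in $V(C)$, these being adjacent; $G$ is hole-with-hat-free if it has no hole-with-hat. Disjoint $A,B\subseteq V(G)$ are complete to each other if every vertex of $A$ is adjacent to every vertex of $B$, and anticomplete if there are no edges between them. $X\subseteq V(G)$ is anticonnected if the complement of $G[X]$ is connected. A vertex $v\notin C$ is mixed on $C$ if $v$ is neither complete nor anticomplete to $C$. -}

module Defs where

open import Data.Nat using (ℕ; suc; _+_)
open import Data.Fin using (Fin; toℕ)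
open import Data.Fin.Subset using (Subset; _∈_; _∉_)
open import Data.Bool using (Bool; true; false)
open import Data.Product using (Σ; ∃; _×_; _,_)
open import Data.Sum using (_⊎_)
open import Relation.Nullary using (¬_)
open import Relation.Binary.PropositionalEquality using (_≡_; _≢_)
open import Function.Bundles using (_⇔_)
open import Function.Definitions using (Injective)

record Graph : Set where
  field
    n     : ℕ
    adj   : Fin n → Fin n → Bool
    sym   : ∀ x y → adj x y ≡ adj y x
    irrefl : ∀ x → adj x x ≡ false

module _ (G : Graph) where
  open Graph G

  Adj : Fin n → Fin n → Set
  Adj x y = adj x y ≡ true

  CycSucc : (k : ℕ) → Fin k → Fin k → Set
  CycSucc k i j = (toℕ j ≡ suc (toℕ i)) ⊎ (suc (toℕ i) ≡ k × toℕ j ≡ 0)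

  CycAdj : (k : ℕ) → Fin k → Fin k → Set
  CycAdj k i j = CycSucc k i j ⊎ CycSucc k j i

  -- a hole: an induced cycle c(0) c(1) ... c(k-1) of length k ≥ 4 in G,
  -- given as an injective map whose induced adjacency is exactly cyclic adjacency
  IsHole : (k : ℕ) → (Fin k → Fin n) → Set
  IsHole k c = (4 Data.Nat.≤ k) × Injective _≡_ _≡_ c × (∀ i j → Adj (c i) (c j) ⇔ CycAdj k i j)

  IsHat : (k : ℕ) → (Fin k → Fin n) → Fin n → Set
  IsHat k c v =
    (∀ i → c i ≢ v) ×
    Σ (Fin k) λ a → Σ (Fin k) λ b →
      a ≢ b × Adj (c a) (c b) × (∀ j → Adj v (c j) ⇔ (j ≡ a ⊎ j ≡ b))

  HasHoleWithHat : Set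
  HasHoleWithHat = Σ ℕ λ k → Σ (Fin k → Fin n) λ c → Σ (Fin n) λ v → IsHole k c × IsHat k c v

  HoleWithHatFree : Set
  HoleWithHatFree = ¬ HasHoleWithHat

  Disjoint : Subset n → Subset n → Set
  Disjoint A B = ∀ x → x ∈ A → x ∉ B

  Complete : Subset n → Subset n → Set
  Complete A B = ∀ x y → x ∈ A → y ∈ B → Adj x y

  -- paths in the complement of G[X]: consecutive vertices are distinct and non-adjacent in G
  data CoReach (X : Subset n) : Fin n → Fin n → Set where
    here : ∀ {x} → CoReach X x x
    step : ∀ {x y z} → y ∈ X → x ≢ y → ¬ Adj x y → CoReach X y z → CoReach X x z

  Anticonnected : Subset n → Set
  Anticonnected X = ∀ x y → x ∈ X → y ∈ X → CoReach X x y

  Mixed : Fin n → Subset n → Set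
  Mixed v C = (Σ (Fin n) λ c → c ∈ C × Adj v c) × (Σ (Fin n) λ c → c ∈ C × ¬ Adj v c)

module Submission where

-- If v is mixed on an anticonnected set X, follow a path of the
-- complement of G[X] from a neighbour of v to a non-neighbour of v: at
-- the step where it leaves the neighbourhood of v we find an antiedge
-- of X (two distinct non-adjacent vertices a, b ∈ X) split by v, i.e.
-- v is adjacent to a but not to b.  Given antiedges a₁b₁ of C and a₂b₂
-- of D split by v, completeness of C to D makes a₁ a₂ b₁ b₂ an induced
-- 4-cycle (a copy of K₂,₂) on which v sees exactly the adjacent pair
-- a₁, a₂: a hole-with-hat.

open import Defs
open import Data.Bool using (Bool; true; false)
import Data.Bool.Properties as Bool
open import Data.Empty using (⊥-elim)
open import Data.Fin using (Fin; zero; suc; toℕ)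
import Data.Fin.Properties as Fin
open import Data.Fin.Subset using (Subset; _∈_; _∉_)
open import Data.Nat using (suc; z≤n; s≤s)
import Data.Nat.Properties as ℕ
open import Data.Product using (Σ; _×_; _,_; proj₁; proj₂)
import Data.Product.Properties as Product
open import Data.Sum using (_⊎_)
open import Function.Bundles using (_⇔_; mk⇔; Equivalence)
import Function.Properties.Equivalence as ⇔
open import Relation.Nullary using (¬_; Dec)
open import Relation.Nullary.Decidable
  using (toWitness; map′; _×-dec_; _⊎-dec_; _→-dec_; ¬?)
open import Relation.Binary.PropositionalEquality
  using (_≡_; _≢_; refl; sym; trans; cong; subst)

_⇔-dec_ : ∀ {a b} {A : Set a} {B : Set b} → Dec A → Dec B → Dec (A ⇔ B)
a? ⇔-dec b? =
  map′ (λ (to , from) → mk⇔ to from)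
       (λ e → Equivalence.to e , Equivalence.from e)
       ((a? →-dec b?) ×-dec (b? →-dec a?))

-- The 4-cycle 0 1 2 3.  A position i is labelled by its side (false for
-- the first set, true for the second) and its slot within that side
-- (false for the vertex seen by the hat, true for the other one).
module Cycle4 (G : Graph) where

  label : Fin 4 → Bool × Bool
  label zero                   = false , false
  label (suc zero)             = true  , false
  label (suc (suc zero))       = false , true
  label (suc (suc (suc zero))) = true  , true

  side : Fin 4 → Bool
  side i = proj₁ (label i)

  slot : Fin 4 → Bool
  slot i = proj₂ (label i)

  cycAdj? : ∀ {k} (i j : Fin k) → Dec (CycAdj G k i j)
  cycAdj? {k} i j = cycSucc? i j ⊎-dec cycSucc? j i
    where
    cycSucc? : ∀ i j → Dec (CycSucc G k i j)
    cycSucc? i j =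
      (toℕ j ℕ.≟ suc (toℕ i)) ⊎-dec ((suc (toℕ i) ℕ.≟ k) ×-dec (toℕ j ℕ.≟ 0))

  cycAdj⇔sides : ∀ i j → CycAdj G 4 i j ⇔ (side i ≢ side j)
  cycAdj⇔sides = toWitness {a? = Fin.all? λ i → Fin.all? λ j →
    cycAdj? i j ⇔-dec ¬? (side i Bool.≟ side j)} _

  label-injective : ∀ i j → label i ≡ label j → i ≡ j
  label-injective = toWitness {a? = Fin.all? λ i → Fin.all? λ j →
    Product.≡-dec Bool._≟_ Bool._≟_ (label i) (label j) →-dec (i Fin.≟ j)} _

  slot⇔hatFeet : ∀ j → (slot j ≡ false) ⇔ (j ≡ zero ⊎ j ≡ suc zero)
  slot⇔hatFeet = toWitness {a? = Fin.all? λ j →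
    (slot j Bool.≟ false) ⇔-dec ((j Fin.≟ zero) ⊎-dec (j Fin.≟ suc zero))} _

module _ (G : Graph) where
  open Graph G using (n)

  adj-sym : ∀ {x y} → Adj G x y → Adj G y x
  adj-sym {x} {y} x∼y = trans (Graph.sym G y x) x∼y

  adj-irrefl : ∀ {x} → ¬ Adj G x x
  adj-irrefl {x} x∼x with trans (sym x∼x) (Graph.irrefl G x)
  ... | ()

  adj⇒≢ : ∀ {x y} → Adj G x y → x ≢ y
  adj⇒≢ x∼y refl = adj-irrefl x∼y

  record Antiedge (X : Subset n) : Set where
    field
      a b  : Fin n
      a∈X  : a ∈ X
      b∈X  : b ∈ X
      a≢b  : a ≢ b
      a≁b  : ¬ Adj G a b

    end : Bool → Fin n
    end false = a
    end true  = b

    end-∈ : ∀ k → end k ∈ X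
    end-∈ false = a∈X
    end-∈ true  = b∈X

    end-nonadj : ∀ k k′ → ¬ Adj G (end k) (end k′)
    end-nonadj false false = adj-irrefl
    end-nonadj false true  = a≁b
    end-nonadj true  false = λ b∼a → a≁b (adj-sym b∼a)
    end-nonadj true  true  = adj-irrefl

    end-injective : ∀ k k′ → end k ≡ end k′ → k ≡ k′
    end-injective false false _  = refl
    end-injective false true  eq = ⊥-elim (a≢b eq)
    end-injective true  false eq = ⊥-elim (a≢b (sym eq))
    end-injective true  true  _  = refl

  open Antiedge using (end; end-∈; end-nonadj; end-injective)

  Splits : ∀ {X} → Fin n → Antiedge X → Set
  Splits v e = ∀ k → Adj G v (end e k) ⇔ (k ≡ false)

  -- An antipath of X from a neighbour x of v to a non-neighbour y of v
  -- contains an antiedge split by v: the step where it leaves N(v).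
  antipath-split : ∀ {X v x y} → x ∈ X → Adj G v x → ¬ Adj G v y →
                   CoReach G X x y → Σ (Antiedge X) (Splits v)
  antipath-split x∈X v∼x v≁y here = ⊥-elim (v≁y v∼x)
  antipath-split {X} {v} {x} x∈X v∼x v≁y (step {y = z} z∈X x≢z x≁z z⇝y)
    with Graph.adj G v z in v?z
  ... | true  = antipath-split z∈X v?z v≁y z⇝y
  ... | false = e , splits
    where
    e : Antiedge X
    e = record { a = x ; b = z ; a∈X = x∈X ; b∈X = z∈X ; a≢b = x≢z ; a≁b = x≁z }

    v≁z : ¬ Adj G v z
    v≁z v∼z with trans (sym v∼z) v?z
    ... | ()

    splits : Splits v e
    splits false = mk⇔ (λ _ → refl) (λ _ → v∼x)
    splits true  = mk⇔ (λ v∼z → ⊥-elim (v≁z v∼z)) (λ ())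

  mixed-split : ∀ {X v} → Anticonnected G X → Mixed G v X → Σ (Antiedge X) (Splits v)
  mixed-split antiX ((x , x∈X , v∼x) , (y , y∈X , v≁y)) =
    antipath-split x∈X v∼x v≁y (antiX x y x∈X y∈X)

  module Square {C D : Subset n} (complete : Complete G C D)
                (e : Antiedge C) (f : Antiedge D) where
    open Cycle4 G

    point : Bool → Bool → Fin n
    point false = end e
    point true  = end f

    point-adj : ∀ s k s′ k′ → Adj G (point s k) (point s′ k′) ⇔ (s ≢ s′)
    point-adj false k false k′ = mk⇔ (λ p → ⊥-elim (end-nonadj e k k′ p)) (λ s≢s → ⊥-elim (s≢s refl))
    point-adj false k true  k′ = mk⇔ (λ _ ()) (λ _ → complete _ _ (end-∈ e k) (end-∈ f k′))
    point-adj true  k false k′ = mk⇔ (λ _ ()) (λ _ → adj-sym (complete _ _ (end-∈ e k′) (end-∈ f k)))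
    point-adj true  k true  k′ = mk⇔ (λ p → ⊥-elim (end-nonadj f k k′ p)) (λ s≢s → ⊥-elim (s≢s refl))

    point-injective : ∀ s k s′ k′ → point s k ≡ point s′ k′ → (s , k) ≡ (s′ , k′)
    point-injective false k false k′ eq = cong (false ,_) (end-injective e k k′ eq)
    point-injective true  k true  k′ eq = cong (true ,_) (end-injective f k k′ eq)
    point-injective false k true  k′ eq =
      ⊥-elim (adj⇒≢ (Equivalence.from (point-adj false k true k′) (λ ())) eq)
    point-injective true  k false k′ eq =
      ⊥-elim (adj⇒≢ (Equivalence.from (point-adj true k false k′) (λ ())) eq)

    corner : Fin 4 → Fin n
    corner i = point (side i) (slot i)

    square-hole : IsHole G 4 corner
    square-hole = s≤s (s≤s (s≤s (s≤s z≤n))) , injective , adjacency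
      where
      injective : ∀ {i j} → corner i ≡ corner j → i ≡ j
      injective {i} {j} eq =
        label-injective i j (point-injective (side i) (slot i) (side j) (slot j) eq)

      adjacency : ∀ i j → Adj G (corner i) (corner j) ⇔ CycAdj G 4 i j
      adjacency i j = ⇔.trans (point-adj (side i) (slot i) (side j) (slot j))
                              (⇔.sym (cycAdj⇔sides i j))

    square-hat : ∀ {v} → v ∉ C → v ∉ D → Splits v e → Splits v f → IsHat G 4 corner v
    square-hat {v} v∉C v∉D splitsE splitsF =
      corner≢v , zero , suc zero , (λ ()) , corner₀∼corner₁ , sees
      where
      point≢v : ∀ s k → point s k ≢ v
      point≢v false k eq = v∉C (subst (_∈ C) eq (end-∈ e k))
      point≢v true  k eq = v∉D (subst (_∈ D) eq (end-∈ f k))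

      corner≢v : ∀ i → corner i ≢ v
      corner≢v i = point≢v (side i) (slot i)

      corner₀∼corner₁ : Adj G (corner zero) (corner (suc zero))
      corner₀∼corner₁ = Equivalence.from (point-adj false false true false) (λ ())

      sees-point : ∀ s k → Adj G v (point s k) ⇔ (k ≡ false)
      sees-point false = splitsE
      sees-point true  = splitsF

      sees : ∀ j → Adj G v (corner j) ⇔ (j ≡ zero ⊎ j ≡ suc zero)
      sees j = ⇔.trans (sees-point (side j) (slot j)) (slot⇔hatFeet j)

  mixed-on-both⇒holeWithHat : ∀ {C D v} → Complete G C D →
    Anticonnected G C → Anticonnected G D → v ∉ C → v ∉ D →
    Mixed G v C → Mixed G v D → HasHoleWithHat G
  mixed-on-both⇒holeWithHat {v = v} complete antiC antiD v∉C v∉D mixedC mixedD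
    with mixed-split antiC mixedC | mixed-split antiD mixedD
  ... | e , splitsE | f , splitsF =
    4 , corner , v , square-hole , square-hat v∉C v∉D splitsE splitsF
    where open Square complete e f

mainTheorem4 : (G : Graph) → HoleWithHatFree G →
               (C D : Subset (Graph.n G)) →
               Disjoint G C D → Anticonnected G C → Anticonnected G D → Complete G C D →
               ∀ v → v ∉ C → v ∉ D → ¬ (Mixed G v C × Mixed G v D)
mainTheorem4 G holeWithHatFree C D _ antiC antiD complete v v∉C v∉D (mixedC , mixedD) =
  holeWithHatFree (mixed-on-both⇒holeWithHat G complete antiC antiD v∉C v∉D mixedC mixedD)
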